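{- Let $\Sigma$ be a signed simple graph and let $v$ be a vertex with $d^+(v)\le 1$. Then $\Sigma^v$ has no fully negative circles through $v$, and the set of fully negative circles of $\Sigma^v$ is a subset of the set of fully negative circles of $\Sigma$. Furthermore, if $\Sigma$ has a fully negative circle through $v$, then $\Sigma^v$ has strictly fewer fully negative circles than $\Sigma$.
   Context: A signed graph is a pair $\Sigma=(\Gamma,\sigma)$ with $\sigma: E(\Gamma)\to\{+,-\}$. $d^+(v)$ denotes the number of positive edges at $v$ (positive degree). $\Sigma^v$ denotes the signed graph obtained by switching $v$, i.e., negating every edge incident with $v$. A circle (cycle) is fully negative if all its edges are negative. -}

module Defs where

open import Data.Nat using (ℕ; zero; suc; _+_)
open import Data.Bool using (Bool; true; false)
open import Data.Fin using (Fin; zero; suc; toℕ; lower₁; _≟_)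
open import Data.Vec using (Vec; []; _∷_; lookup)
open import Data.List using (List; []; _∷_; map; concatMap; length; filter)
open import Data.List using (allFin) renaming (map to lmap)
open import Data.Product using (Σ; ∃; _×_; _,_)
open import Data.Sum using (_⊎_)
open import Relation.Nullary using (Dec; yes; no; ¬_)
open import Relation.Unary using (Decidable)
open import Relation.Binary.PropositionalEquality using (_≡_; _≢_)
open import Function using (_⇔_)
open import Function.Definitions using (Injective)

data Sign : Set where
  pos neg : Sign

flipSign : Sign → Sign
flipSign pos = neg
flipSign neg = pos

-- A signed simple graph on the vertex set Fin n:
-- adjacency is symmetric and irreflexive (no loops; no multiple edges
-- by construction); the signature assigns a sign to each (unordered) pair,
-- only its values on edges matter.
record SignedGraph (n : ℕ) : Set where
  field
    adj       : Fin n → Fin n → Bool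
    sgn       : Fin n → Fin n → Sign
    adj-sym   : ∀ x y → adj x y ≡ adj y x
    adj-irr   : ∀ x → adj x x ≡ false
    sgn-sym   : ∀ x y → sgn x y ≡ sgn y x
open SignedGraph public

incidentOnce : ∀ {n} → Fin n → Fin n → Fin n → Bool
incidentOnce v x y with x ≟ v | y ≟ v
... | yes _ | yes _ = false
... | yes _ | no _  = true
... | no _  | yes _ = true
... | no _  | no _  = false

switchSign : Bool → Sign → Sign
switchSign true  s = flipSign s
switchSign false s = s

switch : ∀ {n} → SignedGraph n → Fin n → SignedGraph n
switch {n} G v = record
  { adj = adj G
  ; sgn = λ x y → switchSign (incidentOnce v x y) (sgn G x y)
  ; adj-sym = adj-sym G
  ; adj-irr = adj-irr G
  ; sgn-sym = sym'
  }
  where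
  open import Relation.Binary.PropositionalEquality using (cong₂)
  io-sym : ∀ x y → incidentOnce v x y ≡ incidentOnce v y x
  io-sym x y with x ≟ v | y ≟ v
  ... | yes _ | yes _ = _≡_.refl
  ... | yes _ | no _  = _≡_.refl
  ... | no _  | yes _ = _≡_.refl
  ... | no _  | no _  = _≡_.refl
  sym' : ∀ x y → switchSign (incidentOnce v x y) (sgn G x y)
                 ≡ switchSign (incidentOnce v y x) (sgn G y x)
  sym' x y = cong₂ switchSign (io-sym x y) (sgn-sym G x y)

isPosEdge : ∀ {n} → SignedGraph n → Fin n → Fin n → Set
isPosEdge G x y = (adj G x y ≡ true) × (sgn G x y ≡ pos)

isPosEdge? : ∀ {n} (G : SignedGraph n) (x : Fin n) → Decidable (isPosEdge G x)
isPosEdge? G x y with adj G x y | sgn G x y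
... | true  | pos = yes (_≡_.refl , _≡_.refl)
... | true  | neg = no (λ { (_ , ()) })
... | false | _   = no (λ { (() , _) })

posDeg : ∀ {n} → SignedGraph n → Fin n → ℕ
posDeg {n} G v = length (filter (isPosEdge? G v) (allFin n))

EdgeSet : ℕ → Set
EdgeSet n = Vec (Vec Bool n) n

_∋ₑ_—_ : ∀ {n} → EdgeSet n → Fin n → Fin n → Set
C ∋ₑ x — y = lookup (lookup C x) y ≡ true

next : ∀ {m} → Fin (suc m) → Fin (suc m)
next {m} i with m Data.Nat.≟ toℕ i
... | yes _ = zero
... | no ne = suc (lower₁ i ne)

-- C is (the edge set of) a circle of the graph G: there is a cyclic sequence
-- w₀, …, w_{k-1} (k ≥ 3) of pairwise distinct vertices with consecutive ones
-- adjacent in G, and C is exactly the set of edges {wᵢ w_{i+1}} (indices mod k),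
-- stored symmetrically.
IsCircle : ∀ {n} → SignedGraph n → EdgeSet n → Set
IsCircle {n} G C =
  Σ ℕ λ k → Σ (Fin (3 + k) → Fin n) λ w →
    Injective _≡_ _≡_ w ×
    (∀ i → adj G (w i) (w (next i)) ≡ true) ×
    (∀ x y → (C ∋ₑ x — y) ⇔
       (∃ λ i → ((x ≡ w i) × (y ≡ w (next i))) ⊎ ((y ≡ w i) × (x ≡ w (next i)))))

AllNegative : ∀ {n} → SignedGraph n → EdgeSet n → Set
AllNegative {n} G C = ∀ (x y : Fin n) → C ∋ₑ x — y → sgn G x y ≡ neg

FullyNegCircle : ∀ {n} → SignedGraph n → EdgeSet n → Set
FullyNegCircle G C = IsCircle G C × AllNegative G C

Through : ∀ {n} → EdgeSet n → Fin n → Set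
Through C v = ∃ λ y → C ∋ₑ v — y

allVecs : ∀ {A : Set} → List A → (k : ℕ) → List (Vec A k)
allVecs xs zero    = [] ∷ []
allVecs xs (suc k) = concatMap (λ x → map (x ∷_) (allVecs xs k)) xs

allEdgeSets : (n : ℕ) → List (EdgeSet n)
allEdgeSets n = allVecs (allVecs (true ∷ false ∷ []) n) n

-- Number of edge sets satisfying a (decidable) predicate P.  The value does
-- not depend on which decision procedure is used.
countEdgeSets : ∀ {n} (P : EdgeSet n → Set) → Decidable P → ℕ
countEdgeSets {n} P P? = length (filter P? (allEdgeSets n))

-- A fully negative circle of Σ^v through v leaves v along two distinct edges; both are
-- switched, so both are positive in Σ and d⁺(v) ≥ 2.  Hence, when d⁺(v) ≤ 1, the fully
-- negative circles of Σ^v avoid v, and switching v does not change the signs of their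
-- edges: they are fully negative circles of Σ.  A fully negative circle of Σ through v is
-- therefore counted for Σ but not for Σ^v.
module Submission where

open import Defs
open import Data.Nat using (zero; suc; _+_; _≤_; _<_; z≤n; s≤s) renaming (_≟_ to _≟ℕ_)
open import Data.Nat.Properties using (≤-trans; m≤n⇒m≤1+n; m≢1+n+m; n≮n)
open import Data.Fin using (Fin; zero; suc; toℕ; fromℕ; inject₁; _≟_)
open import Data.Fin.Properties using (toℕ<n; toℕ-fromℕ; toℕ-inject₁; toℕ-lower₁; lower₁-inject₁′)
open import Data.Bool using (true; false)
open import Data.Vec using (Vec; []; _∷_)
open import Data.List using (List; []; _∷_; length; filter; map)
open import Data.List.Properties using (filter-reject; filter-notAll)
open import Data.List.Relation.Unary.Any using (Any; here; there)
open import Data.List.Membership.Propositional using (_∈_; lose)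
open import Data.List.Membership.Propositional.Properties using (∈-allFin; ∈-concatMap⁺; ∈-map⁺; ∈-filter⁺)
open import Data.Product using (_×_; ∃; ∃₂; _,_)
open import Data.Sum using (_⊎_; inj₁; inj₂)
open import Function using (_∘_; Equivalence)
open import Level using (Level)
open import Relation.Nullary using (¬_; yes; no; contradiction)
open import Relation.Unary using (Pred; Decidable; _⊆′_)
open import Relation.Binary.PropositionalEquality using (_≡_; _≢_; refl; sym; trans; cong; subst; ≢-sym)

module _ {a p q : Level} {A : Set a} {P : Pred A p} {Q : Pred A q}
         (P? : Decidable P) (Q? : Decidable Q) (P⊆Q : P ⊆′ Q) where

  filter-filter-⊆ : ∀ xs → filter P? (filter Q? xs) ≡ filter P? xs
  filter-filter-⊆ [] = refl
  filter-filter-⊆ (x ∷ xs) with Q? x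
  ... | no ¬qx = trans (filter-filter-⊆ xs) (sym (filter-reject P? (¬qx ∘ P⊆Q x)))
  ... | yes _ with P? x
  ...   | yes _ = cong (x ∷_) (filter-filter-⊆ xs)
  ...   | no _  = filter-filter-⊆ xs

  length-filter-<-⊆ : ∀ {y} xs → y ∈ xs → Q y → ¬ P y →
                      length (filter P? xs) < length (filter Q? xs)
  length-filter-<-⊆ xs y∈xs qy ¬py =
    subst (_< length (filter Q? xs)) (cong length (filter-filter-⊆ xs))
      (filter-notAll P? (filter Q? xs) (lose (∈-filter⁺ Q? y∈xs qy) ¬py))

∈-∈-≢⇒2≤length : ∀ {a} {A : Set a} {a b : A} {xs : List A} → a ∈ xs → b ∈ xs → a ≢ b → 2 ≤ length xs
∈-∈-≢⇒2≤length (here refl) (here refl) a≢b = contradiction refl a≢b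
∈-∈-≢⇒2≤length (here _)    (there b∈)  _   = s≤s (∈⇒1≤length b∈)
  where
  ∈⇒1≤length : ∀ {a} {A : Set a} {x : A} {xs} → x ∈ xs → 1 ≤ length xs
  ∈⇒1≤length (here _)  = s≤s z≤n
  ∈⇒1≤length (there _) = s≤s z≤n
∈-∈-≢⇒2≤length (there a∈)  (here refl) a≢b = ∈-∈-≢⇒2≤length (here refl) (there a∈) (≢-sym a≢b)
∈-∈-≢⇒2≤length (there a∈)  (there b∈)  a≢b = m≤n⇒m≤1+n (∈-∈-≢⇒2≤length a∈ b∈ a≢b)

∈-allVecs : ∀ {A : Set} (xs : List A) → (∀ a → a ∈ xs) → ∀ k (u : Vec A k) → u ∈ allVecs xs k
∈-allVecs xs complete zero    []      = here refl
∈-allVecs xs complete (suc k) (a ∷ u) =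
  ∈-concatMap⁺ (λ y → map (y ∷_) (allVecs xs k)) (extend (complete a))
  where
  extend : ∀ {ys} → a ∈ ys → Any (λ y → a ∷ u ∈ map (y ∷_) (allVecs xs k)) ys
  extend (here refl) = here (∈-map⁺ (a ∷_) (∈-allVecs xs complete k u))
  extend (there a∈)  = there (extend a∈)

∈-allEdgeSets : ∀ {n} (C : EdgeSet n) → C ∈ allEdgeSets n
∈-allEdgeSets {n} C = ∈-allVecs _ (∈-allVecs _ ∈-bools n) n C
  where
  ∈-bools : ∀ b → b ∈ true ∷ false ∷ []
  ∈-bools true  = here refl
  ∈-bools false = there (here refl)

next-wraps-or-steps : ∀ {m} (i : Fin (suc m)) →
  (toℕ i ≡ m × next i ≡ zero) ⊎ toℕ (next i) ≡ suc (toℕ i)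
next-wraps-or-steps {m} i with m ≟ℕ toℕ i
... | yes m≡i = inj₁ (sym m≡i , refl)
... | no  m≢i = inj₂ (cong suc (toℕ-lower₁ i m≢i))

next-surjective : ∀ {m} (j : Fin (suc m)) → ∃ λ i → next i ≡ j
next-surjective {m} zero = fromℕ m , wraps
  where
  wraps : next (fromℕ m) ≡ zero
  wraps with m ≟ℕ toℕ (fromℕ m)
  ... | yes _   = refl
  ... | no  m≢m = contradiction (sym (toℕ-fromℕ m)) m≢m
next-surjective {suc m} (suc j) = inject₁ j , steps
  where
  steps : next (inject₁ j) ≡ suc j
  steps with suc m ≟ℕ toℕ (inject₁ j)
  ... | yes m≡j = contradiction (subst (_< suc m) (trans (sym (toℕ-inject₁ j)) (sym m≡j)) (toℕ<n j))
                                (n≮n (suc m))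
  ... | no  m≢j = cong suc (lower₁-inject₁′ j m≢j)

-- Needs at least three positions: in Fin 2 the successor is an involution.
next∘next≢id : ∀ {k} (i : Fin (3 + k)) → next (next i) ≢ i
next∘next≢id i eq with next-wraps-or-steps i | next-wraps-or-steps (next i)
... | inj₁ (_ , i↦0) | inj₁ (ni≡m , _) =
  contradiction (trans (cong toℕ (sym i↦0)) ni≡m) λ ()
... | inj₁ (i≡m , i↦0) | inj₂ steps =
  contradiction (trans (sym (trans steps (cong (suc ∘ toℕ) i↦0))) (trans (cong toℕ eq) i≡m)) λ ()
... | inj₂ steps | inj₁ (ni≡m , ni↦0) =
  contradiction (trans (sym (trans steps (cong (suc ∘ toℕ) (trans (sym eq) ni↦0)))) ni≡m) λ ()
... | inj₂ steps | inj₂ steps′ =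
  m≢1+n+m (toℕ i) (trans (cong toℕ (sym eq)) (trans steps′ (cong suc steps)))

adj⇒≢ : ∀ {n} (G : SignedGraph n) {x y} → adj G x y ≡ true → x ≢ y
adj⇒≢ G {x} xy refl with trans (sym xy) (adj-irr G x)
... | ()

module _ {n} (G : SignedGraph n) (C : EdgeSet n) where

  circle-edge⇒adj : IsCircle G C → ∀ {x y} → C ∋ₑ x — y → adj G x y ≡ true
  circle-edge⇒adj (_ , w , _ , w-adj , C⇔) {x} {y} xy with Equivalence.to (C⇔ x y) xy
  ... | i , inj₁ (refl , refl) = w-adj i
  ... | i , inj₂ (refl , refl) = trans (adj-sym G x y) (w-adj i)

  circle-edge-sym : IsCircle G C → ∀ {x y} → C ∋ₑ x — y → C ∋ₑ y — x
  circle-edge-sym (_ , _ , _ , _ , C⇔) {x} {y} xy with Equivalence.to (C⇔ x y) xy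
  ... | i , inj₁ e = Equivalence.from (C⇔ y x) (i , inj₂ e)
  ... | i , inj₂ e = Equivalence.from (C⇔ y x) (i , inj₁ e)

  -- The neighbours of v = w j on the circle are w (next j) and w p with next p ≡ j.
  circle-two-neighbours : IsCircle G C → ∀ {v} → Through C v →
                          ∃₂ λ a b → a ≢ b × C ∋ₑ v — a × C ∋ₑ v — b
  circle-two-neighbours (_ , w , w-inj , _ , C⇔) {v} (y , vy) =
    neighbours (position (Equivalence.to (C⇔ v y) vy))
    where
    position : (∃ λ i → (v ≡ w i × y ≡ w (next i)) ⊎ (y ≡ w i × v ≡ w (next i))) →
               ∃ λ j → w j ≡ v
    position (i , inj₁ (v≡wi , _))  = i , sym v≡wi
    position (i , inj₂ (_ , v≡wi+)) = next i , sym v≡wi+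

    neighbours : (∃ λ j → w j ≡ v) → ∃₂ λ a b → a ≢ b × C ∋ₑ v — a × C ∋ₑ v — b
    neighbours (j , refl) with next-surjective j
    ... | p , p↦j =
      w (next j) , w p , next∘next≢id j ∘ (λ e → trans (cong next (w-inj e)) p↦j) ,
      Equivalence.from (C⇔ _ _) (j , inj₁ (refl , refl)) ,
      Equivalence.from (C⇔ _ _) (p , inj₂ (refl , cong w (sym p↦j)))

module _ {n} (G : SignedGraph n) (v : Fin n) where

  sgn-switch-away : ∀ {x y} → x ≢ v → y ≢ v → sgn (switch G v) x y ≡ sgn G x y
  sgn-switch-away {x} {y} x≢v y≢v with x ≟ v | y ≟ v
  ... | yes x≡v | _       = contradiction x≡v x≢v
  ... | no _    | yes y≡v = contradiction y≡v y≢v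
  ... | no _    | no _    = refl

  sgn-switch-at : ∀ {y} → y ≢ v → sgn (switch G v) v y ≡ flipSign (sgn G v y)
  sgn-switch-at {y} y≢v with v ≟ v | y ≟ v
  ... | no v≢v | _       = contradiction refl v≢v
  ... | yes _  | yes y≡v = contradiction y≡v y≢v
  ... | yes _  | no _    = refl

flipSign≡neg⇒≡pos : ∀ {s} → flipSign s ≡ neg → s ≡ pos
flipSign≡neg⇒≡pos {pos} _ = refl

2≤posDeg : ∀ {n} (G : SignedGraph n) (v : Fin n) {a b} → a ≢ b →
           isPosEdge G v a → isPosEdge G v b → 2 ≤ posDeg G v
2≤posDeg G v {a} {b} a≢b va vb =
  ∈-∈-≢⇒2≤length (∈-filter⁺ (isPosEdge? G v) (∈-allFin a) va)
                 (∈-filter⁺ (isPosEdge? G v) (∈-allFin b) vb) a≢b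

module _ {n} (G : SignedGraph n) (v : Fin n) (d⁺v≤1 : posDeg G v ≤ 1) where

  switch-fullyNeg-avoids : ∀ C → FullyNegCircle (switch G v) C → ¬ Through C v
  switch-fullyNeg-avoids C (circle , negative) through with circle-two-neighbours G C circle through
  ... | a , b , a≢b , va , vb = 2≰1 (≤-trans (2≤posDeg G v a≢b (positive va) (positive vb)) d⁺v≤1)
    where
    2≰1 : ¬ 2 ≤ 1
    2≰1 (s≤s ())
    positive : ∀ {z} → C ∋ₑ v — z → isPosEdge G v z
    positive {z} vz =
      let v-z = circle-edge⇒adj G C circle vz in
      v-z , flipSign≡neg⇒≡pos (trans (sym (sgn-switch-at G v (≢-sym (adj⇒≢ G v-z)))) (negative v z vz))

  switch-fullyNeg⇒fullyNeg : ∀ C → FullyNegCircle (switch G v) C → FullyNegCircle G C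
  switch-fullyNeg⇒fullyNeg C Cv@(circle , negative) = circle , negative′
    where
    negative′ : AllNegative G C
    negative′ x y xy = trans (sym (sgn-switch-away G v x≢v y≢v)) (negative x y xy)
      where
      x≢v : x ≢ v
      x≢v refl = switch-fullyNeg-avoids C Cv (y , xy)
      y≢v : y ≢ v
      y≢v refl = switch-fullyNeg-avoids C Cv (x , circle-edge-sym G C circle xy)

lemma4p2 : ∀ {n} (G : SignedGraph n) (v : Fin n) → posDeg G v ≤ 1 →
    (∀ C → FullyNegCircle (switch G v) C → ¬ Through C v) ×
    (∀ C → FullyNegCircle (switch G v) C → FullyNegCircle G C) ×
    ((∃ λ C → FullyNegCircle G C × Through C v) →
      (dG : Decidable (FullyNegCircle G)) →
      (dGv : Decidable (FullyNegCircle (switch G v))) →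
      countEdgeSets (FullyNegCircle (switch G v)) dGv
        < countEdgeSets (FullyNegCircle G) dG)
lemma4p2 G v d⁺v≤1 =
  switch-fullyNeg-avoids G v d⁺v≤1 ,
  switch-fullyNeg⇒fullyNeg G v d⁺v≤1 ,
  λ { (C , C-fullyNeg , through) dG dGv →
        length-filter-<-⊆ dGv dG (switch-fullyNeg⇒fullyNeg G v d⁺v≤1) (allEdgeSets _)
          (∈-allEdgeSets C) C-fullyNeg (λ Cv → switch-fullyNeg-avoids G v d⁺v≤1 C Cv through) }
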